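{- Let $(\mathbf o;\mathbf f_1,\mathbf f_2)$ be an integer frame splitting an integer slope $Q$ with vertices $\mathbf v_0,\dots,\mathbf v_N$, with notation as in the context. Then $$\hat\pi(E_1)\ge (v_{k-1,1}^+ + v_{k-1,2}-1)+\delta+(t-s)+\lfloor(-v_{k2}-1)\alpha\rfloor,$$ where $\delta=1$ if $v_{k-1,2}>0$ and $\alpha\in\mathbb{Z}$, and $\delta=0$ otherwise.
   Context: An integer frame is $(\mathbf o;\mathbf f_1,\mathbf f_2)$ with $\mathbf o\in\mathbb{Z}^2$ and $(\mathbf f_1,\mathbf f_2)$ a basis of $\mathbb{Z}^2$. $Q$ is an integer slope w.r.t. $(\mathbf f_1,\mathbf f_2)$: vertices $\mathbf v_0,\dots,\mathbf v_N\in\mathbb{Z}^2$ with $\mathbf a_i=\mathbf v_i-\mathbf v_{i-1}=a_{i1}\mathbf f_1+a_{i2}\mathbf f_2$, $a_{i1}>0,a_{i2}<0$ ($1\le i\le N$), $a_{i1}a_{i+1,2}-a_{i+1,1}a_{i2}>0$ ($1\le i\le N-1$); edges $\varepsilon_i=[\mathbf v_{i-1},\mathbf v_i]$, $E=\{\varepsilon_1,\dots,\varepsilon_N\}$. Write $\mathbf v_i-\mathbf o=v_{i1}\mathbf f_1+v_{i2}\mathbf f_2$. The frame splits $Q$: $v_{01}<0$, $v_{02}>0$, $v_{N1}>0$, $v_{N2}<0$, and some point $\mathbf o+\lambda_1\mathbf f_1+\lambda_2\mathbf f_2\in Q$ has $\lambda_1,\lambda_2>0$. Let $k=\min\{i:v_{i2}<0\}$,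 $\alpha=-a_{k1}/a_{k2}$, $t=\lceil\alpha\rceil-1$, $S=\{\varepsilon_i:i<k,\ a_{i2}=-1\}$, $s=|S|$. With $x^+=\max(x,0)$, set $\pi_1(\varepsilon_i)=v_{i1}^+-v_{i-1,1}^+$, $\pi_2(\varepsilon_i)=v_{i-1,2}^+-v_{i2}^+$, $\hat\pi(\varepsilon_i)=\pi_1(\varepsilon_i)+\pi_2(\varepsilon_i)-2$, extended additively to subsets of $E$. $E_1=\{\varepsilon_1,\dots,\varepsilon_k\}$. -}

module Defs where

open import Data.Nat as ℕ using (ℕ; zero; suc)
open import Data.Integer as ℤ using (ℤ; +_; -[1+_]; _+_; _-_; _*_; -_; _⊔_)
open import Data.Rational as ℚ using (ℚ)
open import Data.Bool using (if_then_else_)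
open import Relation.Nullary using (does)

_⁺ : ℤ → ℤ
x ⁺ = x ⊔ + 0

Σ₁ : ℕ → (ℕ → ℤ) → ℤ
Σ₁ zero    f = + 0
Σ₁ (suc n) f = Σ₁ n f + f (suc n)

-- the rational number a₁ / (-a₂), used only when a₂ < 0
-- (junk value 0 when a₂ ≥ 0, never used under the hypotheses)
negRatio : ℤ → ℤ → ℚ
negRatio a₁ (+ _)     = ℚ.0ℚ
negRatio a₁ -[1+ m ]  = a₁ ℚ./ suc m

-- A slope given by frame coordinates (v i 1, v i 2) = coordinates of v_i - o.
module Slope (v₁ v₂ : ℕ → ℤ) where
  a₁ a₂ : ℕ → ℤ
  a₁ i = v₁ i - v₁ (i ℕ.∸ 1)
  a₂ i = v₂ i - v₂ (i ℕ.∸ 1)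

  π₁ π₂ π̂ : ℕ → ℤ
  π₁ i = (v₁ i) ⁺ - (v₁ (i ℕ.∸ 1)) ⁺
  π₂ i = (v₂ (i ℕ.∸ 1)) ⁺ - (v₂ i) ⁺
  π̂ i = π₁ i + π₂ i - + 2

  -- π̂(E₁) for E₁ = {ε₁,…,ε_k}
  π̂E₁ : ℕ → ℤ
  π̂E₁ k = Σ₁ k π̂

  sCount : ℕ → ℤ
  sCount k = Σ₁ (k ℕ.∸ 1) (λ i → if does (a₂ i ℤ.≟ -[1+ 0 ]) then + 1 else + 0)

  α : ℕ → ℚ
  α k = negRatio (a₁ k) (a₂ k)

  tVal : ℕ → ℤ
  tVal k = ℚ.ceiling (α k) - + 1

open import Data.Product using (_×_; _,_)

det : ℤ × ℤ → ℤ × ℤ → ℤ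
det (x₁ , y₁) (x₂ , y₂) = x₁ * y₂ - x₂ * y₁

framePt : ℤ × ℤ → ℤ × ℤ → ℤ × ℤ → ℤ → ℤ → ℤ × ℤ
framePt (o₁ , o₂) (x₁ , y₁) (x₂ , y₂) c₁ c₂ = (o₁ + c₁ * x₁ + c₂ * x₂ , o₂ + c₁ * y₁ + c₂ * y₂)

module Submission where

-- Proof idea.  Let k = j + 1 be the first edge ending below the first axis,
-- B = -a_{k2} > 0, A = a_{k1} > 0 (so α = A/B), and split π̂(E₁) as the sum over
-- the first j edges plus π̂(ε_k).
--
-- * First j edges.  They run above the first axis, so π₂(εᵢ) = -a_{i2} ≥ 2 unless
--   a_{i2} = -1 (the edges counted by s); telescoping the first coordinate gives
--   v_{j1}⁺ ≤ π̂(ε₁ … ε_j) + s  (Staircase.first-edges).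
-- * Last edge.  π̂(ε_k) = G + v_{j2} - 2 with G = v_{k1}⁺ - v_{j1}⁺.  Since the split
--   point of Q lies on ε_k (Staircase.crossing), B·G ≥ -v_{k2}·A, strictly when
--   v_{j2} > 0 (LastEdge.gain-bound).  Writing the rational quantities ⌈α⌉ and
--   ⌊(-v_{k2}-1)α⌋ through their integer bounds, this yields
--   δ + ⌈α⌉ + ⌊(-v_{k2}-1)α⌋ ≤ G  (LastEdge.last-edge).
-- * Adding both estimates gives the theorem (assemble).
-- Only the directions of the edges, the position of v₀ and the split point are
-- used.

open import Defs
open import Data.Nat as ℕ using (ℕ; suc; zero; z≤n; s≤s)
import Data.Nat.Properties as ℕP
open import Data.Integer as ℤ using (ℤ; +_; -[1+_]; _+_; _-_; _*_; -_; _≤_; _<_; +≤+; +<+)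
open import Data.Integer.Properties
import Data.Integer.DivMod as ℤD
open import Data.Integer.Tactic.RingSolver using (solve-∀)
open import Data.Rational as ℚ using (ℚ; mkℚ; ↥_; ↧_; toℚᵘ)
import Data.Rational.Properties as ℚP
open import Data.Rational.Unnormalised using (mkℚᵘ; *≡*) renaming (_≃_ to _≃ᵘ_)
import Data.Rational.Unnormalised.Properties as ℚᵘP
open import Data.Product using (Σ; ∃; _×_; _,_; proj₁; proj₂)
open import Data.Sum using (_⊎_; inj₁; inj₂)
open import Data.Bool using (if_then_else_)
open import Data.Empty using (⊥-elim)
open import Relation.Nullary using (¬_; does; yes; no)
open import Relation.Binary.Definitions using (tri<; tri≈; tri>)
open import Relation.Binary.PropositionalEquality

⁺-of-nonNeg : ∀ {x} → + 0 ≤ x → x ⁺ ≡ x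
⁺-of-nonNeg = i≥j⇒i⊔j≡i

⁺-of-nonPos : ∀ {x} → x ≤ + 0 → x ⁺ ≡ + 0
⁺-of-nonPos = i≤j⇒i⊔j≡j

≤-+-nonNeg : ∀ i {j} → + 0 ≤ j → i ≤ i + j
≤-+-nonNeg i p = subst (_≤ i + _) (+-identityʳ i) (+-monoʳ-≤ i p)

<-+-pos : ∀ i {j} → + 0 < j → i < i + j
<-+-pos i p = subst (_< i + _) (+-identityʳ i) (+-monoʳ-< i p)

*-nonNeg : ∀ {a b} → + 0 ≤ a → + 0 ≤ b → + 0 ≤ a * b
*-nonNeg {a} {b} 0≤a 0≤b =
  subst (_≤ a * b) (*-zeroʳ a) (*-monoˡ-≤-nonNeg a {{ℤ.nonNegative 0≤a}} 0≤b)

*-pos : ∀ {a b} → + 0 < a → + 0 < b → + 0 < a * b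
*-pos {a} {b} 0<a 0<b = subst (_< a * b) (*-zeroʳ a) (*-monoˡ-<-pos a {{ℤ.positive 0<a}} 0<b)

scaled-neg : ∀ q {x} → x < + 0 → + suc q * x < + 0
scaled-neg q {x} x<0 = subst (+ suc q * x <_) (*-zeroʳ (+ suc q)) (*-monoˡ-<-pos (+ suc q) x<0)

<-suc⇒≤ : ∀ {u v} → u < v + + 1 → u ≤ v
<-suc⇒≤ {u} {v} u<v+1 =
  subst₂ _≤_ (cancel-left u) (cancel-right v) (+-monoˡ-≤ (- + 1) (i<j⇒suc[i]≤j u<v+1))
  where cancel-left : ∀ u → + 1 + u - + 1 ≡ u
        cancel-left = solve-∀
        cancel-right : ∀ v → v + + 1 - + 1 ≡ v
        cancel-right = solve-∀

-- `p ≐ a /suc n` says that the (normalised) rational p equals a/(n+1).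
_≐_/suc_ : ℚ → ℤ → ℕ → Set
p ≐ a /suc n = toℚᵘ p ≃ᵘ mkℚᵘ a n

fraction-≐ : ∀ a n → (a ℚ./ suc n) ≐ a /suc n
fraction-≐ a n = ℚP.toℚᵘ-fromℚᵘ (mkℚᵘ a n)

negRatio-≐ : ∀ a d → d < + 0 → ∃ λ n → d ≡ -[1+ n ] × negRatio a d ≐ a /suc n
negRatio-≐ a -[1+ n ] _       = n , refl , fraction-≐ a n
negRatio-≐ a (+ n)    (+<+ ())

neg-≐ : ∀ {p a n} → p ≐ a /suc n → (ℚ.- p) ≐ (- a) /suc n
neg-≐ {p} p≐ = ℚᵘP.≃-trans (ℚP.toℚᵘ-homo‿- p) (ℚᵘP.-‿cong p≐)

scale-≐ : ∀ {p a n} m → p ≐ a /suc n → ((m ℚ./ 1) ℚ.* p) ≐ (m * a) /suc n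
scale-≐ {p} {a} {n} m p≐ = ℚᵘP.≃-trans (ℚP.toℚᵘ-homo-* (m ℚ./ 1) p)
  (ℚᵘP.≃-trans (ℚᵘP.*-cong (fraction-≐ m 0) p≐)
    (*≡* (cong (λ d → m * a * + suc d) (sym (ℕP.+-identityʳ n)))))

cross-≐ : ∀ {p a n} → p ≐ a /suc n → ↥ p * + suc n ≡ a * ↧ p
cross-≐ {mkℚ _ _ _} (*≡* eq) = eq

integral-≐ : ∀ {p a n} z → p ≐ a /suc n → p ≡ z ℚ./ 1 → a ≡ z * + suc n
integral-≐ {p} {a} {n} z p≐ refl with ℚᵘP.≃-trans (ℚᵘP.≃-sym p≐) (fraction-≐ z 0)
... | *≡* eq = trans (sym (*-identityʳ a)) eq

swap-last : ∀ x y z → x * y * z ≡ x * z * y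
swap-last = solve-∀

-- ⌊p⌋ is the quotient of numerator by denominator.
floor-≤ : ∀ p → ℚ.floor p * ↧ p ≤ ↥ p
floor-≤ (mkℚ a d _) = ℤD.[n/d]*d≤n a (+ suc d)

floor-> : ∀ p → ↥ p < ℤ.suc (ℚ.floor p) * ↧ p
floor-> (mkℚ a d _) rewrite ℤD.div-pos-is-/ℕ a (suc d) {{_}} = ℤD.n<s[n/ℕd]*d a (suc d)

floor-≐ : ∀ {p a n} → p ≐ a /suc n → ℚ.floor p * + suc n ≤ a
floor-≐ {p} {a} {n} p≐ = *-cancelʳ-≤-pos _ a (↧ p) (begin
  ℚ.floor p * B * ↧ p   ≡⟨ swap-last (ℚ.floor p) B (↧ p) ⟩
  ℚ.floor p * ↧ p * B   ≤⟨ *-monoʳ-≤-nonNeg B (floor-≤ p) ⟩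
  ↥ p * B               ≡⟨ cross-≐ p≐ ⟩
  a * ↧ p               ∎)
  where open ≤-Reasoning
        B = + suc n

floor-≐-upper : ∀ {p a n} → p ≐ a /suc n → a < ℤ.suc (ℚ.floor p) * + suc n
floor-≐-upper {p} {a} {n} p≐ = *-cancelʳ-<-nonNeg (↧ p) (begin-strict
  a * ↧ p                          ≡⟨ cross-≐ p≐ ⟨
  ↥ p * B                          <⟨ *-monoʳ-<-pos B (floor-> p) ⟩
  ℤ.suc (ℚ.floor p) * ↧ p * B      ≡⟨ swap-last (ℤ.suc (ℚ.floor p)) (↧ p) B ⟩
  ℤ.suc (ℚ.floor p) * B * ↧ p      ∎)
  where open ≤-Reasoning
        B = + suc n

-- If p = a/B then ⌈p⌉·B < a + B, since ⌈p⌉ = -⌊-p⌋.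
ceiling-≐ : ∀ {p a n} → p ≐ a /suc n → ℚ.ceiling p * + suc n < a + + suc n
ceiling-≐ {p@(mkℚ _ _ _)} {a} {n} p≐ = begin-strict
  - f * B                   ≡⟨ reorder f B ⟩
  - (ℤ.suc f * B) + B       <⟨ +-monoˡ-< B (neg-mono-< (floor-≐-upper (neg-≐ p≐))) ⟩
  - - a + B                 ≡⟨ cong (_+ B) (neg-involutive a) ⟩
  a + B                     ∎
  where open ≤-Reasoning
        B = + suc n
        f = ℚ.floor (ℚ.- p)
        reorder : ∀ x y → - x * y ≡ - ((+ 1 + x) * y) + y
        reorder = solve-∀

Σ₁-+ : ∀ n (f g : ℕ → ℤ) → Σ₁ n (λ i → f i + g i) ≡ Σ₁ n f + Σ₁ n g
Σ₁-+ zero    f g = refl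
Σ₁-+ (suc n) f g = trans (cong (_+ (f (suc n) + g (suc n))) (Σ₁-+ n f g))
                         (interchange (Σ₁ n f) (Σ₁ n g) (f (suc n)) (g (suc n)))
  where interchange : ∀ a b c d → a + b + (c + d) ≡ a + c + (b + d)
        interchange = solve-∀

telescope-≤ : ∀ (f g : ℕ → ℤ) n → (∀ i → 1 ℕ.≤ i → i ℕ.≤ n → f i - f (i ℕ.∸ 1) ≤ g i) →
              f n - f 0 ≤ Σ₁ n g
telescope-≤ f g zero    _    = ≤-reflexive (+-inverseʳ (f 0))
telescope-≤ f g (suc n) step = begin
  f (suc n) - f 0                   ≡⟨ split (f (suc n)) (f n) (f 0) ⟩
  (f n - f 0) + (f (suc n) - f n)   ≤⟨ +-mono-≤ earlier (step (suc n) (s≤s z≤n) ℕP.≤-refl) ⟩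
  Σ₁ n g + g (suc n)                ∎
  where
    open ≤-Reasoning
    split : ∀ a b c → a - c ≡ (b - c) + (a - b)
    split = solve-∀
    earlier : f n - f 0 ≤ Σ₁ n g
    earlier = telescope-≤ f g n (λ i 1≤i i≤n → step i 1≤i (ℕP.m≤n⇒m≤1+n i≤n))

steps-mono : ∀ (f : ℕ → ℤ) N → (∀ i → 1 ℕ.≤ i → i ℕ.≤ N → f (i ℕ.∸ 1) ≤ f i) →
             ∀ {a b} → a ℕ.≤′ b → b ℕ.≤ N → f a ≤ f b
steps-mono f N step (ℕ.≤′-reflexive refl) _   = ≤-refl
steps-mono f N step (ℕ.≤′-step {b} a≤′b) b+1≤N =
  ≤-trans (steps-mono f N step a≤′b (ℕP.≤-trans (ℕP.n≤1+n b) b+1≤N)) (step (suc b) (s≤s z≤n) b+1≤N)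

segment-below-end : ∀ (p q : ℕ) u u' → p ℕ.≤ q → u ≤ u' → + q * u + + p * (u' - u) ≤ + q * u'
segment-below-end p q u u' p≤q u≤u' = begin
  + q * u + + p * (u' - u)                           ≤⟨ ≤-+-nonNeg _ (*-nonNeg (i≤j⇒0≤j-i (+≤+ p≤q)) (i≤j⇒0≤j-i u≤u')) ⟩
  + q * u + + p * (u' - u) + (+ q - + p) * (u' - u)  ≡⟨ collect (+ p) (+ q) u u' ⟩
  + q * u'                                           ∎
  where
    open ≤-Reasoning
    collect : ∀ p q u u' → q * u + p * (u' - u) + (q - p) * (u' - u) ≡ q * u'
    collect = solve-∀

segment-below-start : ∀ (p q : ℕ) u u' → u' ≤ u → + q * u + + p * (u' - u) ≤ + q * u
segment-below-start p q u u' u'≤u = begin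
  + q * u + + p * (u' - u)   ≤⟨ +-monoʳ-≤ (+ q * u) (*-monoˡ-≤-nonNeg (+ p) (i≤j⇒i-j≤0 u'≤u)) ⟩
  + q * u + + p * + 0        ≡⟨ cong (λ t → + q * u + t) (*-zeroʳ (+ p)) ⟩
  + q * u + + 0              ≡⟨ +-identityʳ (+ q * u) ⟩
  + q * u                    ∎
  where open ≤-Reasoning

-- An edge from (x, y) to (x', w) with x' - x = A > 0 and y - w = B > 0, starting
-- on or above the first axis (y ≥ 0).  G is its gain in the positive part of the
-- first coordinate.
module LastEdge (x x' w : ℤ) (n : ℕ) where
  B A y G : ℤ
  B = + suc n
  A = x' - x
  y = w + B
  G = x' ⁺ - x ⁺

  -- If the edge meets the first axis at a positive first coordinate
  -- x + (y/B)·A > 0 whenever x < 0, then B·G ≥ -w·A, strictly when y > 0.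
  gain-bound : + 0 < A → + 0 ≤ y → (x < + 0 → + 0 < B * x + y * A) →
               (- w) * A ≤ B * G × (+ 0 < y → (- w) * A < B * G)
  gain-bound 0<A 0≤y crossing with x ℤ.<? + 0
  ... | yes x<0 = <⇒≤ strict , λ _ → strict
    where
      strict : (- w) * A < B * G
      strict = begin-strict
        (- w) * A                     <⟨ <-+-pos _ (crossing x<0) ⟩
        (- w) * A + (B * x + y * A)   ≡⟨ endpoint x x' w B ⟩
        B * x'                        ≤⟨ *-monoˡ-≤-nonNeg B (i≤i⊔j x' (+ 0)) ⟩
        B * x' ⁺                      ≡⟨ cong (B *_) (+-identityʳ (x' ⁺)) ⟨
        B * (x' ⁺ - + 0)              ≡⟨ cong (λ t → B * (x' ⁺ - t)) (⁺-of-nonPos (<⇒≤ x<0)) ⟨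
        B * G                         ∎
        where open ≤-Reasoning
              endpoint : ∀ x x' w b → (- w) * (x' - x) + (b * x + (w + b) * (x' - x)) ≡ b * x'
              endpoint = solve-∀
  ... | no x≮0 = subst ((- w) * A ≤_) B*G≡ (≤-+-nonNeg _ (*-nonNeg 0≤y (<⇒≤ 0<A))) ,
                 λ 0<y → subst ((- w) * A <_) B*G≡ (<-+-pos _ (*-pos 0<y 0<A))
    where
      0≤x : + 0 ≤ x
      0≤x = ≮⇒≥ x≮0
      -- both endpoints are right of the second axis, so G = A = (-w + y)·A / B
      B*G≡ : (- w) * A + y * A ≡ B * G
      B*G≡ = begin
        (- w) * A + y * A   ≡⟨ combine w B A ⟩
        B * A               ≡⟨ cong (λ t → B * (t - x)) (⁺-of-nonNeg (≤-trans 0≤x (0≤i-j⇒j≤i {x'} {x} (<⇒≤ 0<A)))) ⟨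
        B * (x' ⁺ - x)      ≡⟨ cong (λ t → B * (x' ⁺ - t)) (⁺-of-nonNeg 0≤x) ⟨
        B * G               ∎
        where open ≡-Reasoning
              combine : ∀ w b a → (- w) * a + (w + b) * a ≡ b * a
              combine = solve-∀

  -- With c = ⌈A/B⌉ and F = ⌊(-w-1)·A/B⌋ given by their integer bounds, and δ = 1
  -- only if y > 0 and B ∣ A:  δ + c + F ≤ G.
  last-edge : (c F δ : ℤ) → + 0 < A → + 0 ≤ y → (x < + 0 → + 0 < B * x + y * A) →
              c * B < A + B → F * B ≤ (- w - + 1) * A →
              δ ≡ + 0 ⊎ (δ ≡ + 1 × + 0 < y × ∃ λ z → A ≡ z * B) →
              δ + c + F ≤ G
  last-edge c F δ 0<A 0≤y crossing c-bound F-bound (inj₁ refl) =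
    <-suc⇒≤ (*-cancelˡ-<-nonNeg B (begin-strict
      B * (+ 0 + c + F)            ≡⟨ distribute B c F ⟩
      c * B + F * B                <⟨ +-mono-<-≤ c-bound F-bound ⟩
      (A + B) + (- w - + 1) * A    ≡⟨ collect A B w ⟩
      (- w) * A + B                ≤⟨ +-monoˡ-≤ B (proj₁ (gain-bound 0<A 0≤y crossing)) ⟩
      B * G + B                    ≡⟨ factor B G ⟩
      B * (G + + 1)                ∎))
    where
      open ≤-Reasoning
      distribute : ∀ b c f → b * (+ 0 + c + f) ≡ c * b + f * b
      distribute = solve-∀
      collect : ∀ a b w → (a + b) + (- w - + 1) * a ≡ (- w) * a + b
      collect = solve-∀
      factor : ∀ b g → b * g + b ≡ b * (g + + 1)
      factor = solve-∀
  last-edge c F δ 0<A 0≤y crossing c-bound F-bound (inj₂ (refl , 0<y , z , A≡zB)) = begin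
      + 1 + c + F                  ≤⟨ +-mono-≤ (+-monoʳ-≤ (+ 1) c≤z) F≤ ⟩
      + 1 + z + (- w - + 1) * z    ≡⟨ collect z w ⟩
      + 1 + (- w) * z              ≤⟨ i<j⇒suc[i]≤j wz<G ⟩
      G                            ∎
    where
      open ≤-Reasoning
      collect : ∀ z w → + 1 + z + (- w - + 1) * z ≡ + 1 + (- w) * z
      collect = solve-∀
      factor : ∀ z b → z * b + b ≡ (z + + 1) * b
      factor = solve-∀
      reassociate : ∀ b w z → b * ((- w) * z) ≡ (- w) * (z * b)
      reassociate = solve-∀
      c≤z : c ≤ z
      c≤z = <-suc⇒≤ (*-cancelʳ-<-nonNeg B (begin-strict
        c * B          <⟨ c-bound ⟩
        A + B          ≡⟨ cong (_+ B) A≡zB ⟩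
        z * B + B      ≡⟨ factor z B ⟩
        (z + + 1) * B  ∎))
      F≤ : F ≤ (- w - + 1) * z
      F≤ = *-cancelʳ-≤-pos F _ B (begin
        F * B                  ≤⟨ F-bound ⟩
        (- w - + 1) * A        ≡⟨ cong ((- w - + 1) *_) A≡zB ⟩
        (- w - + 1) * (z * B)  ≡⟨ *-assoc (- w - + 1) z B ⟨
        (- w - + 1) * z * B    ∎)
      wz<G : (- w) * z < G
      wz<G = *-cancelˡ-<-nonNeg B (begin-strict
        B * ((- w) * z)    ≡⟨ reassociate B w z ⟩
        (- w) * (z * B)    ≡⟨ cong ((- w) *_) A≡zB ⟨
        (- w) * A          <⟨ proj₂ (gain-bound 0<A 0≤y crossing) 0<y ⟩
        B * G              ∎)

unitDrop : ℤ → ℤ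
unitDrop d = if does (d ℤ.≟ -[1+ 0 ]) then + 1 else + 0

-- A downward step d contributes -d - 2 ≥ 0 to π̂, except for d = -1 which is
-- compensated by unitDrop.
drop-bound : ∀ d → d < + 0 → + 0 ≤ - d - + 2 + unitDrop d
drop-bound -[1+ zero ]  _ = +≤+ z≤n
drop-bound -[1+ suc m ] _ = +≤+ z≤n
drop-bound (+ n)        (+<+ ())

module Staircase (N : ℕ) (v₁ v₂ : ℕ → ℤ)
  (descending : ∀ i → 1 ℕ.≤ i → i ℕ.≤ N → + 0 < Slope.a₁ v₁ v₂ i × Slope.a₂ v₁ v₂ i < + 0) where
  open Slope v₁ v₂

  v₁-mono : ∀ {a b} → a ℕ.≤ b → b ℕ.≤ N → v₁ a ≤ v₁ b
  v₁-mono a≤b = steps-mono v₁ N rises (ℕP.≤⇒≤′ a≤b)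
    where rises : ∀ i → 1 ℕ.≤ i → i ℕ.≤ N → v₁ (i ℕ.∸ 1) ≤ v₁ i
          rises i 1≤i i≤N = 0≤i-j⇒j≤i (<⇒≤ (proj₁ (descending i 1≤i i≤N)))

  v₂-antitone : ∀ {a b} → a ℕ.≤ b → b ℕ.≤ N → v₂ b ≤ v₂ a
  v₂-antitone a≤b b≤N = neg-cancel-≤ (steps-mono (λ i → - v₂ i) N falls (ℕP.≤⇒≤′ a≤b) b≤N)
    where falls : ∀ i → 1 ℕ.≤ i → i ℕ.≤ N → - v₂ (i ℕ.∸ 1) ≤ - v₂ i
          falls i 1≤i i≤N = neg-mono-≤ (i-j≤0⇒i≤j (<⇒≤ (proj₂ (descending i 1≤i i≤N))))

  -- On an edge above the first axis, π₂ = -a_{i2}, so the increase of v₁⁺ is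
  -- bounded by π̂ plus the unit-drop indicator.
  edge-increment : ∀ i → 1 ℕ.≤ i → i ℕ.≤ N → + 0 ≤ v₂ (i ℕ.∸ 1) → + 0 ≤ v₂ i →
                   (v₁ i) ⁺ - (v₁ (i ℕ.∸ 1)) ⁺ ≤ π̂ i + unitDrop (a₂ i)
  edge-increment i 1≤i i≤N above₀ above₁ = begin
    π₁ i                                          ≤⟨ ≤-+-nonNeg (π₁ i) (drop-bound (a₂ i) (proj₂ (descending i 1≤i i≤N))) ⟩
    π₁ i + (- a₂ i - + 2 + unitDrop (a₂ i))       ≡⟨ regroup (π₁ i) (v₂ i) (v₂ (i ℕ.∸ 1)) (unitDrop (a₂ i)) ⟩
    π₁ i + (v₂ (i ℕ.∸ 1) - v₂ i) - + 2 + unitDrop (a₂ i)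
                                                  ≡⟨ cong (λ t → π₁ i + t - + 2 + unitDrop (a₂ i)) π₂≡ ⟨
    π̂ i + unitDrop (a₂ i)                         ∎
    where
      open ≤-Reasoning
      regroup : ∀ x b a u → x + (- (b - a) - + 2 + u) ≡ x + (a - b) - + 2 + u
      regroup = solve-∀
      π₂≡ : π₂ i ≡ v₂ (i ℕ.∸ 1) - v₂ i
      π₂≡ = cong₂ _-_ (⁺-of-nonNeg above₀) (⁺-of-nonNeg above₁)

  first-edges : ∀ j → j ℕ.≤ N → v₁ 0 ≤ + 0 → (∀ i → i ℕ.< suc j → + 0 ≤ v₂ i) →
                (v₁ j) ⁺ ≤ Σ₁ j π̂ + Σ₁ j (λ i → unitDrop (a₂ i))
  first-edges j j≤N left above = begin
    (v₁ j) ⁺                                  ≡⟨ +-identityʳ ((v₁ j) ⁺) ⟨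
    (v₁ j) ⁺ - + 0                            ≡⟨ cong ((v₁ j) ⁺ -_) (⁺-of-nonPos left) ⟨
    (v₁ j) ⁺ - (v₁ 0) ⁺                       ≤⟨ telescope-≤ (λ i → (v₁ i) ⁺) _ j increment ⟩
    Σ₁ j (λ i → π̂ i + unitDrop (a₂ i))        ≡⟨ Σ₁-+ j π̂ (λ i → unitDrop (a₂ i)) ⟩
    Σ₁ j π̂ + Σ₁ j (λ i → unitDrop (a₂ i))     ∎
    where
      open ≤-Reasoning
      increment : ∀ i → 1 ℕ.≤ i → i ℕ.≤ j → (v₁ i) ⁺ - (v₁ (i ℕ.∸ 1)) ⁺ ≤ π̂ i + unitDrop (a₂ i)
      increment i 1≤i i≤j = edge-increment i 1≤i (ℕP.≤-trans i≤j j≤N)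
        (above (i ℕ.∸ 1) (s≤s (ℕP.≤-trans (ℕP.m∸n≤m i 1) i≤j))) (above i (s≤s i≤j))

  -- a point v_{i-1} + (p/q)·a_i of the slope with both coordinates positive
  SplitPoint : Set
  SplitPoint = Σ ℕ λ i → Σ ℕ λ p → Σ ℕ λ q → 1 ℕ.≤ i × i ℕ.≤ N × p ℕ.≤ q × 0 ℕ.< q ×
       (+ 0 < + q * v₁ (i ℕ.∸ 1) + + p * a₁ i) × (+ 0 < + q * v₂ (i ℕ.∸ 1) + + p * a₂ i)

  -- If edge k = j+1 goes below the first axis and v_{j1} < 0, the split point lies
  -- on edge k (earlier edges stay left of the second axis, later ones below the
  -- first), hence edge k meets the first axis at a positive first coordinate.
  crossing : SplitPoint → ∀ j → suc j ℕ.≤ N → v₂ (suc j) < + 0 → v₁ j < + 0 →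
             + 0 < (- a₂ (suc j)) * v₁ j + v₂ j * a₁ (suc j)
  crossing (suc i , p , suc q , _ , i+1≤N , p≤q , _ , right , up) j k≤N below left with ℕP.<-cmp i j
  ... | tri< i<j _ _ = ⊥-elim (<-asym right (begin-strict
        + suc q * v₁ i + + p * a₁ (suc i)   ≤⟨ segment-below-end p (suc q) (v₁ i) (v₁ (suc i)) p≤q (v₁-mono (ℕP.n≤1+n i) i+1≤N) ⟩
        + suc q * v₁ (suc i)                ≤⟨ *-monoˡ-≤-nonNeg (+ suc q) (v₁-mono i<j (ℕP.≤-trans (ℕP.n≤1+n j) k≤N)) ⟩
        + suc q * v₁ j                      <⟨ scaled-neg q left ⟩
        + 0                                 ∎))
    where open ≤-Reasoning
  ... | tri> _ _ j<i = ⊥-elim (<-asym up (begin-strict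
        + suc q * v₂ i + + p * a₂ (suc i)   ≤⟨ segment-below-start p (suc q) (v₂ i) (v₂ (suc i)) (v₂-antitone (ℕP.n≤1+n i) i+1≤N) ⟩
        + suc q * v₂ i                      ≤⟨ *-monoˡ-≤-nonNeg (+ suc q) (v₂-antitone j<i (ℕP.≤-trans (ℕP.n≤1+n i) i+1≤N)) ⟩
        + suc q * v₂ (suc j)                <⟨ scaled-neg q below ⟩
        + 0                                 ∎))
    where open ≤-Reasoning
  ... | tri≈ _ refl _ = *-cancelˡ-<-nonNeg (+ suc q) (begin-strict
        + suc q * + 0                                   ≡⟨ *-zeroʳ (+ suc q) ⟩
        + 0                                             <⟨ +-mono-< (*-pos drop>0 right) (*-pos (proj₁ edge) up) ⟩
        (- b) * (Q * u + P * A) + A * (Q * y + P * b)   ≡⟨ eliminate P Q u y A b ⟩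
        Q * ((- b) * u + y * A)                         ∎)
    where
      open ≤-Reasoning
      edge = descending (suc i) (s≤s z≤n) i+1≤N
      P Q u y A b : ℤ
      P = + p
      Q = + suc q
      u = v₁ i
      y = v₂ i
      A = a₁ (suc i)
      b = a₂ (suc i)
      drop>0 : + 0 < - b
      drop>0 = neg-mono-< (proj₂ edge)
      -- eliminating the parameter p/q of the split point
      eliminate : ∀ P Q u y A b → (- b) * (Q * u + P * A) + A * (Q * y + P * b) ≡ Q * ((- b) * u + y * A)
      eliminate = solve-∀

  DeltaSpec : ℕ → ℤ → Set
  DeltaSpec k δ = (δ ≡ + 1 × (+ 0 < v₂ (k ℕ.∸ 1) × ∃ λ z → α k ≡ z ℚ./ 1)) ⊎
                  (δ ≡ + 0 × ¬ (+ 0 < v₂ (k ℕ.∸ 1) × ∃ λ z → α k ≡ z ℚ./ 1))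

  crossing-edge-gain : ∀ j → suc j ℕ.≤ N → SplitPoint → v₂ (suc j) < + 0 → + 0 ≤ v₂ j →
    ∀ δ → DeltaSpec (suc j) δ →
    δ + ℚ.ceiling (α (suc j)) + ℚ.floor (((- v₂ (suc j) - + 1) ℚ./ 1) ℚ.* α (suc j)) ≤ π₁ (suc j)
  crossing-edge-gain j k≤N split below above δ δ-spec
    with negRatio-≐ (a₁ (suc j)) (a₂ (suc j)) (proj₂ (descending (suc j) (s≤s z≤n) k≤N))
  ... | n , drop , α≐ =
    last-edge _ _ δ (proj₁ (descending (suc j) (s≤s z≤n) k≤N)) (subst (+ 0 ≤_) height above)
      crosses-right (ceiling-≐ α≐) (floor-≐ (scale-≐ (- w - + 1) α≐)) (δ-cases δ-spec)
    where
      x w : ℤ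
      x = v₁ j
      w = v₂ (suc j)
      open LastEdge x (v₁ (suc j)) w n
      height : v₂ j ≡ w + B
      height = trans (undo (v₂ j) w) (cong (λ d → w - d) drop)
        where undo : ∀ y w → y ≡ w - (w - y)
              undo = solve-∀
      crosses-right : x < + 0 → + 0 < B * x + y * A
      crosses-right left = subst₂ (λ b h → + 0 < b * x + h * A) (cong -_ drop) height
                                  (crossing split j k≤N below left)
      δ-cases : DeltaSpec (suc j) δ → δ ≡ + 0 ⊎ (δ ≡ + 1 × + 0 < y × ∃ λ z → A ≡ z * B)
      δ-cases (inj₁ (δ≡1 , high , z , α≡z)) = inj₂ (δ≡1 , subst (+ 0 <_) height high , z , integral-≐ z α≐ α≡z)
      δ-cases (inj₂ (δ≡0 , _))              = inj₁ δ≡0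

assemble : ∀ P {s X G y δ c F π₂} → X ≤ P + s → δ + c + F ≤ G → π₂ ≡ y →
           (X + y - + 1) + δ + ((c - + 1) - s) + F ≤ P + (G + π₂ - + 2)
assemble P {s} {X} {G} {y} {δ} {c} {F} X≤P+s gain refl = begin
  (X + y - + 1) + δ + ((c - + 1) - s) + F   ≡⟨ regroup X y δ c s F ⟩
  (X - s) + (δ + c + F) + (y - + 2)         ≤⟨ +-monoˡ-≤ (y - + 2) (+-mono-≤ X-s≤P gain) ⟩
  P + G + (y - + 2)                         ≡⟨ +-assoc P G (y - + 2) ⟩
  P + (G + (y - + 2))                       ≡⟨ cong (λ t → P + t) (+-assoc G y (- + 2)) ⟨
  P + (G + y - + 2)                         ∎
  where
    open ≤-Reasoning
    regroup : ∀ X y δ c s F → (X + y - + 1) + δ + ((c - + 1) - s) + F ≡ (X - s) + (δ + c + F) + (y - + 2)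
    regroup = solve-∀
    cancel : ∀ P s → P + s - s ≡ P
    cancel = solve-∀
    X-s≤P : X - s ≤ P
    X-s≤P = subst (X - s ≤_) (cancel P s) (+-monoˡ-≤ (- s) X≤P+s)

lemma6p5 : (o f₁ f₂ : ℤ × ℤ) →
    (det f₁ f₂ ≡ + 1) ⊎ (det f₁ f₂ ≡ -[1+ 0 ]) →
    (N : ℕ) (v : ℕ → ℤ × ℤ) (v₁ v₂ : ℕ → ℤ) →
    (∀ i → i ℕ.≤ N → v i ≡ framePt o f₁ f₂ (v₁ i) (v₂ i)) →
    let open Slope v₁ v₂ in
    (∀ i → 1 ℕ.≤ i → i ℕ.≤ N → + 0 ℤ.< a₁ i × a₂ i ℤ.< + 0) →
    (∀ i → 1 ℕ.≤ i → suc i ℕ.≤ N → + 0 ℤ.< a₁ i * a₂ (suc i) - a₁ (suc i) * a₂ i) →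
    v₁ 0 ℤ.< + 0 → + 0 ℤ.< v₂ 0 → + 0 ℤ.< v₁ N → v₂ N ℤ.< + 0 →
    (Σ ℕ λ i → Σ ℕ λ p → Σ ℕ λ q → 1 ℕ.≤ i × i ℕ.≤ N × p ℕ.≤ q × 0 ℕ.< q ×
       (+ 0 ℤ.< + q * v₁ (i ℕ.∸ 1) + + p * a₁ i) × (+ 0 ℤ.< + q * v₂ (i ℕ.∸ 1) + + p * a₂ i)) →
    (k : ℕ) → k ℕ.≤ N → v₂ k ℤ.< + 0 → (∀ i → i ℕ.< k → + 0 ℤ.≤ v₂ i) →
    (δ : ℤ) →
    (δ ≡ + 1 × (+ 0 ℤ.< v₂ (k ℕ.∸ 1) × ∃ λ z → α k ≡ z ℚ./ 1)) ⊎
    (δ ≡ + 0 × ¬ (+ 0 ℤ.< v₂ (k ℕ.∸ 1) × ∃ λ z → α k ≡ z ℚ./ 1)) →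
    π̂E₁ k ℤ.≥
      (((v₁ (k ℕ.∸ 1)) ⁺ + v₂ (k ℕ.∸ 1) - + 1) + δ + (tVal k - sCount k)
        + ℚ.floor (((- v₂ k - + 1) ℚ./ 1) ℚ.* α k))
-- k = 0 is impossible, as v₀ lies above the first axis
lemma6p5 _ _ _ _ _ _ _ _ _ _ _ _ 0<y₀ _ _ _ zero _ y₀<0 _ _ _ = ⊥-elim (<-asym 0<y₀ y₀<0)
lemma6p5 _ _ _ _ N _ v₁ v₂ _ descending _ x₀<0 _ _ _ split (suc j) k≤N below above δ δ-spec =
  assemble (Σ₁ j π̂) (first-edges j (ℕP.<⇒≤ k≤N) (<⇒≤ x₀<0) above)
           (crossing-edge-gain j k≤N split below (above j ℕP.≤-refl) δ δ-spec)
           π₂-last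
  where
    open Slope v₁ v₂
    open Staircase N v₁ v₂ descending
    -- the last edge drops from height v_{j2} ≥ 0 to below the axis
    π₂-last : π₂ (suc j) ≡ v₂ j
    π₂-last = trans (cong₂ _-_ (⁺-of-nonNeg (above j ℕP.≤-refl)) (⁺-of-nonPos (<⇒≤ below)))
                    (+-identityʳ (v₂ j))
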